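{- Let $n,m\in\mathbb N$ and let $(A_1,B_1),(A_2,B_2)\in X_n^\star\times X_m^\star$ be two different pairs such that $A_1B_1=T^kA_2B_2$ for some $k\in\mathbb Z$. Then the matrix entries of $A_1B_1$ have a common divisor strictly larger than $1$.
   Context: $T=\begin{pmatrix}1&1\\0&1\end{pmatrix}$. For $N\in\mathbb N$, $X_N^\star=\{\begin{pmatrix}c&b\\0&N/c\end{pmatrix}:c\ge1,\ c\mid N,\ 0\le b\le N/c-1,\ \gcd(c,b,N/c)=1\}$. -}

module Defs where

open import Data.Nat as ℕ using (ℕ; _<_; _≤_)
open import Data.Nat.GCD using (gcd)
open import Data.Integer as ℤ using (ℤ; +_)
open import Data.Product using (Σ; _×_; ∃-syntax)
open import Relation.Binary.PropositionalEquality using (_≡_)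

record Mat2 : Set where
  constructor mat
  field
    a b c d : ℤ
open Mat2 public

_·_ : Mat2 → Mat2 → Mat2
mat a₁ b₁ c₁ d₁ · mat a₂ b₂ c₂ d₂ =
  mat (a₁ ℤ.* a₂ ℤ.+ b₁ ℤ.* c₂) (a₁ ℤ.* b₂ ℤ.+ b₁ ℤ.* d₂)
      (c₁ ℤ.* a₂ ℤ.+ d₁ ℤ.* c₂) (c₁ ℤ.* b₂ ℤ.+ d₁ ℤ.* d₂)

Tpow : ℤ → Mat2
Tpow k = mat (+ 1) k (+ 0) (+ 1)

-- Membership in X_N^⋆ : M = ( c b ; 0 N/c ) with c ≥ 1, c ∣ N (written c * e = N, e = N/c),
-- 0 ≤ b ≤ N/c - 1, gcd(c, b, N/c) = 1.
InXstar : ℕ → Mat2 → Set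
InXstar N M =
  ∃[ c ] ∃[ e ] ∃[ b ]
    (1 ≤ c × c ℕ.* e ≡ N × b < e × gcd c (gcd b e) ≡ 1 ×
     M ≡ mat (+ c) (+ b) (+ 0) (+ e))

HasCommonDivisor>1 : Mat2 → Set
HasCommonDivisor>1 M =
  ∃[ g ] (1 < g × (+ g) ∣ a M × (+ g) ∣ b M × (+ g) ∣ c M × (+ g) ∣ d M)
  where open import Data.Integer.Divisibility using (_∣_)

{-# OPTIONS --safe #-}

-- Write A = (c b ; 0 e) and B = (c' b' ; 0 e'), so that AB = (cc'  cb' + be' ; 0  ee').
-- If the entries of A₁B₁ have no common divisor > 1, then neither do those of A₂B₂ (any common
-- divisor of them also divides the entries of T^k A₂B₂ = A₁B₁), so c₁ ⊥ e₁' and c₂ ⊥ e₂'.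
-- Coprimality recovers c' = gcd (cc') (c'e') = gcd (cc') m from the product, and then c, e, e'.
-- Comparing upper right entries gives c (b₁' − b₂') = e' (ek − (b₁ − b₂)), so e' ∣ b₁' − b₂',
-- hence b₁' = b₂' as both lie in [0, e'); then e ∣ b₁ − b₂, hence b₁ = b₂.
module Submission where

open import Defs
open import Data.Nat using (ℕ)
open import Data.Integer using (ℤ)
open import Data.Product using (_×_)
open import Relation.Binary.PropositionalEquality using (_≡_)
open import Relation.Nullary using (¬_)

open import Data.Nat.Base as ℕ using (suc; _<_; s≤s; z≤n; NonZero)
import Data.Nat.Properties as ℕ
open import Data.Nat.Divisibility using (_∣_; _∣0; ∣-refl; ∣-trans; ∣1⇒≡1; >⇒∤; m∣m*n)
open import Data.Nat.GCD using (gcd; gcd[m,n]∣m; gcd[m,n]∣n; gcd-greatest; c*gcd[m,n]≡gcd[cm,cn])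
open import Data.Nat.Coprimality as Coprime using (Coprime; coprime⇒gcd≡1)
open import Data.Integer.Base using (+_; 0ℤ; _+_; _*_; _-_; ∣_∣)
import Data.Integer.Properties as ℤ
open import Data.Integer.Divisibility using () renaming (_∣_ to _∣ᵤ_)
import Data.Integer.Divisibility.Signed as ℤ
import Data.Integer.Coprimality as ℤ
open import Data.Integer.Tactic.RingSolver using (solve)
open import Data.List.Base using ([]; _∷_)
open import Data.Product as Product using (_,_; proj₁; proj₂; ∃-syntax)
open import Data.Sum using (_⊎_; inj₁; inj₂)
open import Relation.Binary.PropositionalEquality
  using (_≢_; refl; sym; trans; cong; cong₂; subst; module ≡-Reasoning)
open import Relation.Nullary using (yes; no; contradiction)

mat-cong : ∀ {a b c d a' b' c' d'} →
           a ≡ a' → b ≡ b' → c ≡ c' → d ≡ d' → mat a b c d ≡ mat a' b' c' d'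
mat-cong refl refl refl refl = refl

triangular : ℤ → ℤ → ℤ → Mat2
triangular a b d = mat a b (+ 0) d

triangular-· : ∀ a b d a' b' d' →
  triangular a b d · triangular a' b' d' ≡ triangular (a * a') (a * b' + b * d') (d * d')
triangular-· a b d a' b' d' = mat-cong
  (trans (cong (λ t → a * a' + t) (ℤ.*-zeroʳ b)) (ℤ.+-identityʳ (a * a')))
  refl
  (trans (ℤ.+-identityˡ (d * + 0)) (ℤ.*-zeroʳ d))
  (ℤ.+-identityˡ (d * d'))

Tpow-·-triangular : ∀ k a b d → Tpow k · triangular a b d ≡ triangular a (b + k * d) d
Tpow-·-triangular k a b d = trans (triangular-· (+ 1) k (+ 1) a b d)
  (mat-cong (ℤ.*-identityˡ a) (cong (_+ k * d) (ℤ.*-identityˡ b)) refl (ℤ.*-identityˡ d))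

triangular-injective : ∀ {a b d a' b' d'} →
  triangular a b d ≡ triangular a' b' d' → a ≡ a' × b ≡ b' × d ≡ d'
triangular-injective refl = refl , refl , refl

-- Unsigned divisibility, so that HasCommonDivisor>1 M is literally ∃[ g ] 1 < g × g ∣ₘ M.
infix 4 _∣ₘ_

_∣ₘ_ : ℕ → Mat2 → Set
g ∣ₘ M = + g ∣ᵤ a M × + g ∣ᵤ b M × + g ∣ᵤ c M × + g ∣ᵤ d M

Primitive : Mat2 → Set
Primitive M = ∀ {g} → g ∣ₘ M → g ≡ 1

∣-∣ₘ-trans : ∀ {h g M} → h ∣ g → g ∣ₘ M → h ∣ₘ M
∣-∣ₘ-trans h∣g (g∣a , g∣b , g∣c , g∣d) =
  ∣-trans h∣g g∣a , ∣-trans h∣g g∣b , ∣-trans h∣g g∣c , ∣-trans h∣g g∣d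

gcd-entries : Mat2 → ℕ
gcd-entries M = gcd ∣ a M ∣ (gcd ∣ b M ∣ (gcd ∣ c M ∣ ∣ d M ∣))

gcd-entries-∣ₘ : ∀ M → gcd-entries M ∣ₘ M
gcd-entries-∣ₘ (mat a b c d) =
  gcd[m,n]∣m ∣ a ∣ bcd ,
  ∣-trans (gcd[m,n]∣n ∣ a ∣ bcd) (gcd[m,n]∣m ∣ b ∣ cd) ,
  ∣-trans (gcd[m,n]∣n ∣ a ∣ bcd) (∣-trans (gcd[m,n]∣n ∣ b ∣ cd) (gcd[m,n]∣m ∣ c ∣ ∣ d ∣)) ,
  ∣-trans (gcd[m,n]∣n ∣ a ∣ bcd) (∣-trans (gcd[m,n]∣n ∣ b ∣ cd) (gcd[m,n]∣n ∣ c ∣ ∣ d ∣))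
  where
  cd bcd : ℕ
  cd = gcd ∣ c ∣ ∣ d ∣
  bcd = gcd ∣ b ∣ cd

∣ₘ⇒∣gcd-entries : ∀ {g} M → g ∣ₘ M → g ∣ gcd-entries M
∣ₘ⇒∣gcd-entries M (g∣a , g∣b , g∣c , g∣d) =
  gcd-greatest g∣a (gcd-greatest g∣b (gcd-greatest g∣c g∣d))

≢1⇒∃nontrivial-divisor : ∀ {n} → n ≢ 1 → ∃[ h ] 1 < h × h ∣ n
≢1⇒∃nontrivial-divisor {0}             _   = 2 , s≤s (s≤s z≤n) , 2 ∣0
≢1⇒∃nontrivial-divisor {1}             n≢1 = contradiction refl n≢1
≢1⇒∃nontrivial-divisor {suc (suc n)}   _   = suc (suc n) , s≤s (s≤s z≤n) , ∣-refl

primitive⊎hasCommonDivisor>1 : ∀ M → Primitive M ⊎ HasCommonDivisor>1 M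
primitive⊎hasCommonDivisor>1 M with gcd-entries M ℕ.≟ 1
... | yes gcd≡1 = inj₁ λ {g} g∣M → ∣1⇒≡1 (subst (g ∣_) gcd≡1 (∣ₘ⇒∣gcd-entries M g∣M))
... | no gcd≢1 with ≢1⇒∃nontrivial-divisor gcd≢1
...   | h , 1<h , h∣gcd = inj₂ (h , 1<h , ∣-∣ₘ-trans {M = M} h∣gcd (gcd-entries-∣ₘ M))

∣ₘ-·ˡ : ∀ M {g N} → g ∣ₘ N → g ∣ₘ M · N
∣ₘ-·ˡ (mat a b c d) {g} (g∣a' , g∣b' , g∣c' , g∣d') =
  combination a b g∣a' g∣c' , combination a b g∣b' g∣d' ,
  combination c d g∣a' g∣c' , combination c d g∣b' g∣d'
  where
  combination : ∀ x y {u v} → + g ∣ᵤ u → + g ∣ᵤ v → + g ∣ᵤ x * u + y * v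
  combination x y {u} {v} g∣u g∣v = ℤ.∣⇒∣ᵤ (ℤ.∣m∣n⇒∣m+n
    (ℤ.∣n⇒∣m*n x (ℤ.∣ᵤ⇒∣ {+ g} {u} g∣u)) (ℤ.∣n⇒∣m*n y (ℤ.∣ᵤ⇒∣ {+ g} {v} g∣v)))

primitive-·⇒primitiveʳ : ∀ M {N} → Primitive (M · N) → Primitive N
primitive-·⇒primitiveʳ M prim g∣N = prim (∣ₘ-·ˡ M g∣N)

primitive-triangular-·⇒coprime : ∀ a b d a' b' d' →
  Primitive (triangular a b d · triangular a' b' d') → Coprime ∣ a ∣ ∣ d' ∣
primitive-triangular-·⇒coprime a b d a' b' d' prim {g} (g∣a , g∣d') =
  prim (subst (g ∣ₘ_) (sym (triangular-· a b d a' b' d'))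
    ( ℤ.∣⇒∣ᵤ (ℤ.∣m⇒∣m*n a' g∣ᵃ)
    , ℤ.∣⇒∣ᵤ (ℤ.∣m∣n⇒∣m+n (ℤ.∣m⇒∣m*n b' g∣ᵃ) (ℤ.∣n⇒∣m*n b g∣ᵈ'))
    , g ∣0
    , ℤ.∣⇒∣ᵤ (ℤ.∣n⇒∣m*n d g∣ᵈ')))
  where
  g∣ᵃ : + g ℤ.∣ a
  g∣ᵃ = ℤ.∣ᵤ⇒∣ g∣a
  g∣ᵈ' : + g ℤ.∣ d'
  g∣ᵈ' = ℤ.∣ᵤ⇒∣ g∣d'

∣∧<⇒≡0 : ∀ {g n} → g ∣ n → n < g → n ≡ 0
∣∧<⇒≡0 {n = 0}     _   _   = refl
∣∧<⇒≡0 {n = suc n} g∣n n<g = contradiction g∣n (>⇒∤ n<g)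

∣∣m-n∣⇒m≡n : ∀ {m n o} → m < o → n < o → + o ∣ᵤ + m - + n → m ≡ n
∣∣m-n∣⇒m≡n {m} {n} {o} m<o n<o o∣m-n =
  ℤ.+-injective (ℤ.i-j≡0⇒i≡j (+ m) (+ n) (ℤ.∣i∣≡0⇒i≡0 (∣∧<⇒≡0 o∣m-n ∣m-n∣<o)))
  where
  ∣m-n∣<o : ∣ + m - + n ∣ < o
  ∣m-n∣<o = subst (λ i → ∣ i ∣ < o) (sym (ℤ.m-n≡m⊖n m n))
              (ℕ.≤-<-trans (ℤ.∣m⊝n∣≤m⊔n m n) (ℕ.⊔-pres-<m m<o n<o))

n∣ᵤn*i : ∀ n i → + n ∣ᵤ + n * i
n∣ᵤn*i n i = subst (n ∣_) (sym (ℤ.abs-* (+ n) i)) (m∣m*n ∣ i ∣)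

cross-multiplied : ∀ c e e' b₁ b₂ b₁' b₂' k →
  c * b₁' + b₁ * e' ≡ c * b₂' + b₂ * e' + k * (e * e') →
  c * (b₁' - b₂') ≡ e' * (e * k - (b₁ - b₂))
cross-multiplied c e e' b₁ b₂ b₁' b₂' k eq = begin
  c * (b₁' - b₂')
    ≡⟨ solve (c ∷ e' ∷ b₁ ∷ b₂ ∷ b₁' ∷ b₂' ∷ []) ⟩
  c * b₁' + b₁ * e' - (c * b₂' + b₂ * e') - e' * (b₁ - b₂)
    ≡⟨ cong (λ t → t - (c * b₂' + b₂ * e') - e' * (b₁ - b₂)) eq ⟩
  c * b₂' + b₂ * e' + k * (e * e') - (c * b₂' + b₂ * e') - e' * (b₁ - b₂)
    ≡⟨ solve (c ∷ e ∷ e' ∷ b₁ ∷ b₂ ∷ b₂' ∷ k ∷ []) ⟩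
  e' * (e * k - (b₁ - b₂)) ∎
  where open ≡-Reasoning

offsets-unique : ∀ {c e e' b₁ b₂ b₁' b₂'} k → Coprime c e' →
  b₁ < e → b₂ < e → b₁' < e' → b₂' < e' →
  + c * + b₁' + + b₁ * + e' ≡ + c * + b₂' + + b₂ * + e' + k * (+ e * + e') →
  b₁ ≡ b₂ × b₁' ≡ b₂'
offsets-unique {c} {e} {e'} {b₁} {b₂} {b₁'} {b₂'} k c⊥e' b₁<e b₂<e b₁'<e' b₂'<e' eq =
  b₁≡b₂ , b₁'≡b₂'
  where
  open ≡-Reasoning
  x : ℤ
  x = + b₁' - + b₂'
  y : ℤ
  y = + b₁ - + b₂
  w : ℤ
  w = + e * k - y

  cx≡e'w : + c * x ≡ + e' * w
  cx≡e'w = cross-multiplied (+ c) (+ e) (+ e') (+ b₁) (+ b₂) (+ b₁') (+ b₂') k eq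

  b₁'≡b₂' : b₁' ≡ b₂'
  b₁'≡b₂' = ∣∣m-n∣⇒m≡n b₁'<e' b₂'<e'
    (ℤ.coprime-divisor (+ e') (+ c) x (Coprime.sym c⊥e')
      (subst (+ e' ∣ᵤ_) (sym cx≡e'w) (n∣ᵤn*i e' w)))

  e'w≡e'0 : + e' * w ≡ + e' * 0ℤ
  e'w≡e'0 = begin
    + e' * w   ≡⟨ sym cx≡e'w ⟩
    + c * x    ≡⟨ cong (+ c *_) (ℤ.i≡j⇒i-j≡0 (cong +_ b₁'≡b₂')) ⟩
    + c * 0ℤ   ≡⟨ ℤ.*-zeroʳ (+ c) ⟩
    0ℤ         ≡⟨ sym (ℤ.*-zeroʳ (+ e')) ⟩
    + e' * 0ℤ  ∎

  y≡ek : y ≡ + e * k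
  y≡ek = sym (ℤ.i-j≡0⇒i≡j (+ e * k) y
    (ℤ.*-cancelˡ-≡ (+ e') w 0ℤ {{ℕ.≢-nonZero (ℕ.m<n⇒n≢0 b₁'<e')}} e'w≡e'0))

  b₁≡b₂ : b₁ ≡ b₂
  b₁≡b₂ = ∣∣m-n∣⇒m≡n b₁<e b₂<e (subst (+ e ∣ᵤ_) (sym y≡ek) (n∣ᵤn*i e k))

coprime⇒gcd[m*n,n*o]≡n : ∀ {m o} n → Coprime m o → gcd (m ℕ.* n) (n ℕ.* o) ≡ n
coprime⇒gcd[m*n,n*o]≡n {m} {o} n m⊥o = begin
  gcd (m ℕ.* n) (n ℕ.* o)  ≡⟨ cong (λ t → gcd t (n ℕ.* o)) (ℕ.*-comm m n) ⟩
  gcd (n ℕ.* m) (n ℕ.* o)  ≡⟨ sym (c*gcd[m,n]≡gcd[cm,cn] n m o) ⟩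
  n ℕ.* gcd m o            ≡⟨ cong (n ℕ.*_) (coprime⇒gcd≡1 m⊥o) ⟩
  n ℕ.* 1                  ≡⟨ ℕ.*-identityʳ n ⟩
  n                        ∎
  where open ≡-Reasoning

diagonals-unique : ∀ {c₁ e₁ c₁' e₁' c₂ e₂ c₂' e₂'} .{{_ : NonZero c₁}} .{{_ : NonZero c₁'}} →
  Coprime c₁ e₁' → Coprime c₂ e₂' →
  c₁ ℕ.* e₁ ≡ c₂ ℕ.* e₂ → c₁' ℕ.* e₁' ≡ c₂' ℕ.* e₂' → c₁ ℕ.* c₁' ≡ c₂ ℕ.* c₂' →
  c₁ ≡ c₂ × e₁ ≡ e₂ × c₁' ≡ c₂' × e₁' ≡ e₂'
diagonals-unique {c₁} {e₁} {c₁'} {e₁'} {c₂} {e₂} {c₂'} {e₂'} c₁⊥e₁' c₂⊥e₂' n≡ m≡ C≡ =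
  c₁≡c₂ , e₁≡e₂ , c₁'≡c₂' , e₁'≡e₂'
  where
  open ≡-Reasoning
  c₁'≡c₂' : c₁' ≡ c₂'
  c₁'≡c₂' = begin
    c₁'                               ≡⟨ coprime⇒gcd[m*n,n*o]≡n c₁' c₁⊥e₁' ⟨
    gcd (c₁ ℕ.* c₁') (c₁' ℕ.* e₁')    ≡⟨ cong₂ gcd C≡ m≡ ⟩
    gcd (c₂ ℕ.* c₂') (c₂' ℕ.* e₂')    ≡⟨ coprime⇒gcd[m*n,n*o]≡n c₂' c₂⊥e₂' ⟩
    c₂'                               ∎
  c₁≡c₂ : c₁ ≡ c₂
  c₁≡c₂ = ℕ.*-cancelʳ-≡ c₁ c₂ c₁' (trans C≡ (cong (c₂ ℕ.*_) (sym c₁'≡c₂')))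
  e₁'≡e₂' : e₁' ≡ e₂'
  e₁'≡e₂' = ℕ.*-cancelˡ-≡ e₁' e₂' c₁' (trans m≡ (cong (ℕ._* e₂') (sym c₁'≡c₂')))
  e₁≡e₂ : e₁ ≡ e₂
  e₁≡e₂ = ℕ.*-cancelˡ-≡ e₁ e₂ c₁ (trans n≡ (cong (ℕ._* e₂) (sym c₁≡c₂)))

triangular-factors-unique : ∀ {c₁ e₁ b₁ c₁' e₁' b₁' c₂ e₂ b₂ c₂' e₂' b₂'} k
  .{{_ : NonZero c₁}} .{{_ : NonZero c₁'}} → Coprime c₁ e₁' → Coprime c₂ e₂' →
  c₁ ℕ.* e₁ ≡ c₂ ℕ.* e₂ → c₁' ℕ.* e₁' ≡ c₂' ℕ.* e₂' → c₁ ℕ.* c₁' ≡ c₂ ℕ.* c₂' →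
  b₁ < e₁ → b₂ < e₂ → b₁' < e₁' → b₂' < e₂' →
  + c₁ * + b₁' + + b₁ * + e₁' ≡ + c₂ * + b₂' + + b₂ * + e₂' + k * (+ e₂ * + e₂') →
  triangular (+ c₁) (+ b₁) (+ e₁) ≡ triangular (+ c₂) (+ b₂) (+ e₂) ×
  triangular (+ c₁') (+ b₁') (+ e₁') ≡ triangular (+ c₂') (+ b₂') (+ e₂')
triangular-factors-unique k c₁⊥e₁' c₂⊥e₂' n≡ m≡ C≡ b₁<e₁ b₂<e₂ b₁'<e₁' b₂'<e₂' β≡
  with diagonals-unique c₁⊥e₁' c₂⊥e₂' n≡ m≡ C≡
... | refl , refl , refl , refl =
  Product.map (cong λ b → triangular _ (+ b) _) (cong λ b → triangular _ (+ b) _)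
    (offsets-unique k c₁⊥e₁' b₁<e₁ b₂<e₂ b₁'<e₁' b₂'<e₂' β≡)

factorisation-unique : ∀ {n m A₁ B₁ A₂ B₂} →
  InXstar n A₁ → InXstar m B₁ → InXstar n A₂ → InXstar m B₂ →
  (k : ℤ) → Primitive (A₁ · B₁) → A₁ · B₁ ≡ Tpow k · (A₂ · B₂) → A₁ ≡ A₂ × B₁ ≡ B₂
factorisation-unique
  (c₁  , e₁  , b₁  , s≤s z≤n , refl , b₁<e₁   , _ , refl)
  (c₁' , e₁' , b₁' , s≤s z≤n , refl , b₁'<e₁' , _ , refl)
  (c₂  , e₂  , b₂  , _       , n≡   , b₂<e₂   , _ , refl)
  (c₂' , e₂' , b₂' , _       , m≡   , b₂'<e₂' , _ , refl) k prim₁ eq =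
  triangular-factors-unique k c₁⊥e₁' c₂⊥e₂' (sym n≡) (sym m≡) C≡ b₁<e₁ b₂<e₂ b₁'<e₁' b₂'<e₂' β≡
  where
  A₂ B₂ : Mat2
  A₂ = triangular (+ c₂) (+ b₂) (+ e₂)
  B₂ = triangular (+ c₂') (+ b₂') (+ e₂')
  c₁⊥e₁' : Coprime c₁ e₁'
  c₁⊥e₁' = primitive-triangular-·⇒coprime (+ c₁) (+ b₁) (+ e₁) (+ c₁') (+ b₁') (+ e₁') prim₁
  c₂⊥e₂' : Coprime c₂ e₂'
  c₂⊥e₂' = primitive-triangular-·⇒coprime (+ c₂) (+ b₂) (+ e₂) (+ c₂') (+ b₂') (+ e₂')
             (primitive-·⇒primitiveʳ (Tpow k) {A₂ · B₂} (subst Primitive eq prim₁))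
  products : triangular (+ c₁ * + c₁') (+ c₁ * + b₁' + + b₁ * + e₁') (+ e₁ * + e₁')
           ≡ triangular (+ c₂ * + c₂') (+ c₂ * + b₂' + + b₂ * + e₂' + k * (+ e₂ * + e₂')) (+ e₂ * + e₂')
  products = begin
    triangular (+ c₁ * + c₁') (+ c₁ * + b₁' + + b₁ * + e₁') (+ e₁ * + e₁')
      ≡⟨ triangular-· (+ c₁) (+ b₁) (+ e₁) (+ c₁') (+ b₁') (+ e₁') ⟨
    triangular (+ c₁) (+ b₁) (+ e₁) · triangular (+ c₁') (+ b₁') (+ e₁')
      ≡⟨ eq ⟩
    Tpow k · (A₂ · B₂)
      ≡⟨ cong (Tpow k ·_) (triangular-· (+ c₂) (+ b₂) (+ e₂) (+ c₂') (+ b₂') (+ e₂')) ⟩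
    Tpow k · triangular (+ c₂ * + c₂') (+ c₂ * + b₂' + + b₂ * + e₂') (+ e₂ * + e₂')
      ≡⟨ Tpow-·-triangular k (+ c₂ * + c₂') (+ c₂ * + b₂' + + b₂ * + e₂') (+ e₂ * + e₂') ⟩
    triangular (+ c₂ * + c₂') (+ c₂ * + b₂' + + b₂ * + e₂' + k * (+ e₂ * + e₂')) (+ e₂ * + e₂') ∎
    where open ≡-Reasoning
  C≡ : c₁ ℕ.* c₁' ≡ c₂ ℕ.* c₂'
  C≡ = ℤ.+-injective (trans (ℤ.pos-* c₁ c₁')
         (trans (proj₁ (triangular-injective products)) (sym (ℤ.pos-* c₂ c₂'))))
  β≡ : + c₁ * + b₁' + + b₁ * + e₁' ≡ + c₂ * + b₂' + + b₂ * + e₂' + k * (+ e₂ * + e₂')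
  β≡ = proj₁ (proj₂ (triangular-injective products))

lemma4p6 : (n m : ℕ) (A₁ B₁ A₂ B₂ : Mat2) →
           InXstar n A₁ → InXstar m B₁ → InXstar n A₂ → InXstar m B₂ →
           ¬ ((A₁ ≡ A₂) × (B₁ ≡ B₂)) →
           (k : ℤ) → A₁ · B₁ ≡ Tpow k · (A₂ · B₂) →
           HasCommonDivisor>1 (A₁ · B₁)
lemma4p6 n m A₁ B₁ A₂ B₂ A₁∈X B₁∈X A₂∈X B₂∈X A≢ k eq
  with primitive⊎hasCommonDivisor>1 (A₁ · B₁)
... | inj₁ prim   = contradiction (factorisation-unique A₁∈X B₁∈X A₂∈X B₂∈X k prim eq) A≢
... | inj₂ common = common
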